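{- Let $K$ be a fully idempotent commutative semiring and let $\pi_A:\mathrm{Lit}_A(\tau)\to K$, $\pi_B:\mathrm{Lit}_B(\tau)\to K$ be $K$-interpretations. If there is an $m$-back-and-forth system $(I_j)_{j\le m}$ for $\pi_A$ and $\pi_B$, then $\pi_A\equiv_m\pi_B$.
   Context: Fully idempotent: $a+a=a$ and $a\cdot a=a$ for all $a\in K$. $\tau$ is a finite relational signature, $A,B$ finite; $\mathrm{Lit}_A(\tau)$ is the set of instantiated literals $R\bar a,\neg R\bar a$; a $K$-interpretation is a map from it to $K$. First-order formulae (negation normal form) are evaluated by $a=a\mapsto1$, $a=b\mapsto0$ for $a\ne b$ (dually for $\ne$), literals via $\pi$, $\vee\mapsto+$, $\wedge\mapsto\cdot$, $\exists x\mapsto$ sum over the universe, $\forall x\mapsto$ product over the universe. A partial isomorphism between $\pi_A,\pi_B$ is a bijection $\sigma:X\to Y$ with $X\subseteq A$, $Y\subseteq B$ such that $\pi_A(L)=\pi_B(\sigma(L))$ for all literals $L$ instantiated with elements of $X$ only. An $m$-back-and-forth system is a sequence $(I_j)_{j\le m}$ of finite sets of partial isomorphisms with $\emptyset\in I_m$ and such that for all $j<m$, whenever $\bar a\mapsto\bar b\in I_{j+1}$, then for every $c\in A$ there is $d\in B$, and for every $d\in B$ there is $c\in A$, with $\bar ac\mapsto\bar bd\in I_j$. $\pi_A\equiv_m\pi_B$ means $\pi_A[\![\varphi]\!]=\pi_B[\![\varphi]\!]$ for all first-order sentences $\varphi$ of quantifier rank at most $m$. -}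

module Defs where

open import Level using (Level)
open import Data.Nat using (ℕ; zero; suc; _≤_; _⊔_)
open import Data.Fin using (Fin; zero; suc; _≟_; inject₁; fromℕ)
open import Data.Vec using (Vec; []; _∷_; lookup; replicate)
  renaming (map to vmap)
open import Data.Vec.Relation.Binary.Pointwise.Inductive using (Pointwise)
open import Data.Maybe using (Maybe; just; nothing)
open import Data.List using (List)
open import Data.List.Membership.Propositional using (_∈_)
open import Data.List.Relation.Unary.All using (All)
open import Data.Product using (_×_; ∃; ∃-syntax)
open import Data.Sum using (_⊎_)
open import Function.Bundles using (_⇔_)
open import Relation.Nullary using (yes; no)
open import Relation.Binary.PropositionalEquality using (_≡_)
open import Algebra.Bundles using (CommutativeSemiring)
open import Algebra.Definitions using (Idempotent)

FullyIdempotent : ∀ {c ℓ} → CommutativeSemiring c ℓ → Set (c Level.⊔ ℓ)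
FullyIdempotent K = Idempotent _≈_ _+_ × Idempotent _≈_ _*_
  where open CommutativeSemiring K

record Signature : Set where
  field
    nrel  : ℕ
    arity : Fin nrel → ℕ
open Signature public

-- Finite universes are Fin n.
-- Instantiated literals R ā and ¬ R ā over the universe Fin n.
data Lit (τ : Signature) (n : ℕ) : Set where
  pos : (r : Fin (nrel τ)) → Vec (Fin n) (arity τ r) → Lit τ n
  neg : (r : Fin (nrel τ)) → Vec (Fin n) (arity τ r) → Lit τ n

Interp : ∀ {c ℓ} → CommutativeSemiring c ℓ → Signature → ℕ → Set c
Interp K τ n = Lit τ n → CommutativeSemiring.Carrier K

-- First-order formulae in negation normal form, with k free variables
-- (de Bruijn indices Fin k).

data Formula (τ : Signature) : ℕ → Set where
  eq   : ∀ {k} → Fin k → Fin k → Formula τ k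
  neq  : ∀ {k} → Fin k → Fin k → Formula τ k
  rel  : ∀ {k} (r : Fin (nrel τ)) → Vec (Fin k) (arity τ r) → Formula τ k
  notrel : ∀ {k} (r : Fin (nrel τ)) → Vec (Fin k) (arity τ r) → Formula τ k
  _∨'_ : ∀ {k} → Formula τ k → Formula τ k → Formula τ k
  _∧'_ : ∀ {k} → Formula τ k → Formula τ k → Formula τ k
  ex   : ∀ {k} → Formula τ (suc k) → Formula τ k
  all  : ∀ {k} → Formula τ (suc k) → Formula τ k

Sentence : Signature → Set
Sentence τ = Formula τ 0

qr : ∀ {τ k} → Formula τ k → ℕ
qr (eq _ _)    = 0
qr (neq _ _)   = 0
qr (rel _ _)   = 0
qr (notrel _ _) = 0
qr (φ ∨' ψ)    = qr φ ⊔ qr ψ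
qr (φ ∧' ψ)    = qr φ ⊔ qr ψ
qr (ex φ)      = suc (qr φ)
qr (all φ)     = suc (qr φ)

module _ {c ℓ} (K : CommutativeSemiring c ℓ) where
  open CommutativeSemiring K using (Carrier; _≈_; _+_; _*_; 0#; 1#)

  sumFin : ∀ n → (Fin n → Carrier) → Carrier
  sumFin zero    f = 0#
  sumFin (suc n) f = f zero + sumFin n (λ i → f (suc i))

  prodFin : ∀ n → (Fin n → Carrier) → Carrier
  prodFin zero    f = 1#
  prodFin (suc n) f = f zero * prodFin n (λ i → f (suc i))

  extendEnv : ∀ {n k} → (Fin k → Fin n) → Fin n → Fin (suc k) → Fin n
  extendEnv ρ a zero    = a
  extendEnv ρ a (suc i) = ρ i

  eval : ∀ {τ n k} → Interp K τ n → Formula τ k → (Fin k → Fin n) → Carrier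
  eval π (eq x y) ρ with ρ x ≟ ρ y
  ... | yes _ = 1#
  ... | no  _ = 0#
  eval π (neq x y) ρ with ρ x ≟ ρ y
  ... | yes _ = 0#
  ... | no  _ = 1#
  eval π (rel r xs)   ρ = π (pos r (vmap ρ xs))
  eval π (notrel r xs) ρ = π (neg r (vmap ρ xs))
  eval π (φ ∨' ψ) ρ = eval π φ ρ + eval π ψ ρ
  eval π (φ ∧' ψ) ρ = eval π φ ρ * eval π ψ ρ
  eval {n = n} π (ex φ)  ρ = sumFin n  (λ a → eval π φ (extendEnv ρ a))
  eval {n = n} π (all φ) ρ = prodFin n (λ a → eval π φ (extendEnv ρ a))

  ⟦_⟧_ : ∀ {τ n} → Sentence τ → Interp K τ n → Carrier
  ⟦ φ ⟧ π = eval π φ (λ ())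

  ElemEquiv : ∀ {τ nA nB} → ℕ → Interp K τ nA → Interp K τ nB → Set ℓ
  ElemEquiv {τ} m πA πB =
    (φ : Sentence τ) → qr φ ≤ m → (⟦ φ ⟧ πA) ≈ (⟦ φ ⟧ πB)

  -- Partial maps Fin nA ⇀ Fin nB, as vectors (σ a = nothing means a ∉ dom σ)

  PMap : ℕ → ℕ → Set
  PMap nA nB = Vec (Maybe (Fin nB)) nA

  emptyMap : ∀ {nA nB} → PMap nA nB
  emptyMap = replicate _ nothing

  -- σ is a partial isomorphism between πA and πB: an injective partial map
  -- (i.e. a bijection from its domain X ⊆ A onto its image Y ⊆ B) such that
  -- πA(L) = πB(σ(L)) for all literals L instantiated with elements of X only.
  IsPartialIso : ∀ {τ nA nB} → Interp K τ nA → Interp K τ nB → PMap nA nB → Set ℓ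
  IsPartialIso {τ} πA πB σ =
    (∀ a a' b → lookup σ a ≡ just b → lookup σ a' ≡ just b → a ≡ a')
    × (∀ (r : Fin (nrel τ)) as bs →
         Pointwise (λ a b → lookup σ a ≡ just b) as bs →
         (πA (pos r as) ≈ πB (pos r bs)) × (πA (neg r as) ≈ πB (neg r bs)))

  -- σ' is the map  āc ↦ b̄d  where σ is  ā ↦ b̄, i.e. graph σ' = graph σ ∪ {(c,d)}
  IsExtension : ∀ {nA nB} → PMap nA nB → Fin nA → Fin nB → PMap nA nB → Set
  IsExtension σ c d σ' =
    ∀ a b → (lookup σ' a ≡ just b) ⇔ ((lookup σ a ≡ just b) ⊎ (a ≡ c × b ≡ d))

  -- m-back-and-forth system (I_j)_{j ≤ m}: I j is a finite set (list) of
  -- partial isomorphisms.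
  record BackAndForth {τ nA nB} (m : ℕ) (πA : Interp K τ nA) (πB : Interp K τ nB)
                      : Set ℓ where
    field
      I       : Fin (suc m) → List (PMap nA nB)
      isos    : ∀ j → All (IsPartialIso πA πB) (I j)
      empty∈  : emptyMap ∈ I (fromℕ m)
      forth   : ∀ (j : Fin m) σ → σ ∈ I (suc j) →
                ∀ (c : Fin nA) → ∃[ d ] ∃[ σ' ] (σ' ∈ I (inject₁ j) × IsExtension σ c d σ')
      back    : ∀ (j : Fin m) σ → σ ∈ I (suc j) →
                ∀ (d : Fin nB) → ∃[ c ] ∃[ σ' ] (σ' ∈ I (inject₁ j) × IsExtension σ c d σ')

{-# OPTIONS --safe #-}
-- Induction on formulae: a formula with k free variables has the same value
-- under two assignments whenever some σ ∈ I_j maps the first onto the second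
-- and j bounds the quantifier rank. Atoms are handled by σ being a partial
-- isomorphism; for ∃ (resp. ∀), forth and back show that every summand
-- (resp. factor) on one side equals one on the other side, and in an
-- idempotent commutative monoid such mutually covering families have the
-- same sum.
module Submission where

open import Defs
open import Data.Nat using (ℕ; zero; suc; _≤_; s≤s)
open import Data.Nat.Properties using (m≤m⊔n; m≤n⊔m; ≤-trans)
open import Data.Fin using (Fin; zero; suc; _≟_; inject₁; fromℕ; toℕ)
open import Data.Fin.Properties using (toℕ-inject₁; toℕ-fromℕ)
open import Data.Vec using (Vec; []; _∷_; lookup) renaming (map to vmap)
open import Data.Vec.Functional using (Vector; removeAt)
open import Data.Vec.Relation.Binary.Pointwise.Inductive using (Pointwise; []; _∷_)
open import Data.Maybe using (Maybe; just)
open import Data.Maybe.Properties using (just-injective)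
open import Data.List.Membership.Propositional using (_∈_)
import Data.List.Relation.Unary.All as All
open import Data.Product using (∃-syntax; _,_; proj₁; proj₂)
open import Data.Sum using (inj₁; inj₂)
open import Function.Bundles using (_⇔_; mk⇔; Equivalence)
open import Relation.Nullary using (yes; no; contradiction)
open import Relation.Binary.PropositionalEquality as ≡ using (_≡_; refl; subst)
open import Algebra.Bundles
  using (CommutativeSemiring; CommutativeMonoid; IdempotentCommutativeMonoid)
open import Algebra.Definitions using (Idempotent)
import Algebra.Properties.CommutativeMonoid.Sum as CommutativeMonoidSum
import Relation.Binary.Reasoning.Setoid as SetoidReasoning

module IdempotentSum {c ℓ} (M : IdempotentCommutativeMonoid c ℓ) where
  open IdempotentCommutativeMonoid M
  open CommutativeMonoidSum commutativeMonoid using (sum; sum-remove)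
  open SetoidReasoning setoid

  sum-absorbs : ∀ {n} (g : Vector Carrier n) (i : Fin n) → g i ∙ sum g ≈ sum g
  sum-absorbs {suc n} g i = begin
    g i ∙ sum g                       ≈⟨ ∙-congˡ (sum-remove g) ⟩
    g i ∙ (g i ∙ sum (removeAt g i))  ≈⟨ sym (assoc _ _ _) ⟩
    (g i ∙ g i) ∙ sum (removeAt g i)  ≈⟨ ∙-congʳ (idem _) ⟩
    g i ∙ sum (removeAt g i)          ≈⟨ sym (sum-remove g) ⟩
    sum g                             ∎

  sum-absorbs-sum : ∀ {m n} (f : Vector Carrier m) (g : Vector Carrier n) →
                    (∀ i → ∃[ j ] f i ≈ g j) → sum f ∙ sum g ≈ sum g
  sum-absorbs-sum {zero}  f g covered = identityˡ _
  sum-absorbs-sum {suc m} f g covered with covered zero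
  ... | j , f₀≈gⱼ = begin
    (f zero ∙ sum (λ i → f (suc i))) ∙ sum g  ≈⟨ assoc _ _ _ ⟩
    f zero ∙ (sum (λ i → f (suc i)) ∙ sum g)  ≈⟨ ∙-cong f₀≈gⱼ absorbs-tail ⟩
    g j ∙ sum g                               ≈⟨ sum-absorbs g j ⟩
    sum g                                     ∎
    where
    absorbs-tail : sum (λ i → f (suc i)) ∙ sum g ≈ sum g
    absorbs-tail = sum-absorbs-sum (λ i → f (suc i)) g (λ i → covered (suc i))

  sum-cong-covering : ∀ {m n} (f : Vector Carrier m) (g : Vector Carrier n) →
                      (∀ i → ∃[ j ] f i ≈ g j) → (∀ j → ∃[ i ] f i ≈ g j) →
                      sum f ≈ sum g
  sum-cong-covering f g f⊆g g⊆f = begin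
    sum f          ≈⟨ sym (sum-absorbs-sum g f g⊆f′) ⟩
    sum g ∙ sum f  ≈⟨ comm _ _ ⟩
    sum f ∙ sum g  ≈⟨ sum-absorbs-sum f g f⊆g ⟩
    sum g          ∎
    where
    g⊆f′ : ∀ j → ∃[ i ] g j ≈ f i
    g⊆f′ j with g⊆f j
    ... | i , fᵢ≈gⱼ = i , sym fᵢ≈gⱼ

idempotentCommutativeMonoid : ∀ {c ℓ} (M : CommutativeMonoid c ℓ) →
  let open CommutativeMonoid M in Idempotent _≈_ _∙_ → IdempotentCommutativeMonoid c ℓ
idempotentCommutativeMonoid M idem = record
  { isIdempotentCommutativeMonoid = record
    { isCommutativeMonoid = CommutativeMonoid.isCommutativeMonoid M
    ; idem = idem
    }
  }

module _ {c ℓ} (K : CommutativeSemiring c ℓ) where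
  open CommutativeSemiring K
    using (Carrier; _≈_; _+_; _*_; +-commutativeMonoid; *-commutativeMonoid)
  open CommutativeMonoidSum +-commutativeMonoid using (sum)
  open CommutativeMonoidSum *-commutativeMonoid using () renaming (sum to product)

  sumFin≡sum : ∀ n (f : Fin n → Carrier) → sumFin K n f ≡ sum f
  sumFin≡sum zero    f = refl
  sumFin≡sum (suc n) f = ≡.cong (f zero +_) (sumFin≡sum n (λ i → f (suc i)))

  prodFin≡product : ∀ n (f : Fin n → Carrier) → prodFin K n f ≡ product f
  prodFin≡product zero    f = refl
  prodFin≡product (suc n) f = ≡.cong (f zero *_) (prodFin≡product n (λ i → f (suc i)))

  module _ {nA nB : ℕ} {f : Fin nA → Carrier} {g : Fin nB → Carrier}
           (f⊆g : ∀ a → ∃[ b ] f a ≈ g b) (g⊆f : ∀ b → ∃[ a ] f a ≈ g b) where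

    sumFin-cong-covering : Idempotent _≈_ _+_ → sumFin K nA f ≈ sumFin K nB g
    sumFin-cong-covering idem
      rewrite sumFin≡sum nA f | sumFin≡sum nB g =
      IdempotentSum.sum-cong-covering
        (idempotentCommutativeMonoid +-commutativeMonoid idem) f g f⊆g g⊆f

    prodFin-cong-covering : Idempotent _≈_ _*_ → prodFin K nA f ≈ prodFin K nB g
    prodFin-cong-covering idem
      rewrite prodFin≡product nA f | prodFin≡product nB g =
      IdempotentSum.sum-cong-covering
        (idempotentCommutativeMonoid *-commutativeMonoid idem) f g f⊆g g⊆f

module _ {nA nB : ℕ} where

  record _Maps_To_ {k} (σ : Vec (Maybe (Fin nB)) nA)
                   (ρA : Fin k → Fin nA) (ρB : Fin k → Fin nB) : Set where
    constructor maps
    field lookup-maps : ∀ i → lookup σ (ρA i) ≡ just (ρB i)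
  open _Maps_To_ public

  maps-vmap : ∀ {k l σ} {ρA : Fin k → Fin nA} {ρB : Fin k → Fin nB} → σ Maps ρA To ρB →
              (xs : Vec (Fin k) l) →
              Pointwise (λ a b → lookup σ a ≡ just b) (vmap ρA xs) (vmap ρB xs)
  maps-vmap σρ []       = []
  maps-vmap σρ (x ∷ xs) = lookup-maps σρ x ∷ maps-vmap σρ xs

module _ {c ℓ} (K : CommutativeSemiring c ℓ) {τ : Signature} {nA nB : ℕ}
         {πA : Interp K τ nA} {πB : Interp K τ nB} where
  open CommutativeSemiring K using (_≈_; +-cong; *-cong) renaming (refl to ≈-refl)

  maps-extendEnv : ∀ {k σ a b σ'} {ρA : Fin k → Fin nA} {ρB : Fin k → Fin nB} →
                   IsExtension K σ a b σ' → σ Maps ρA To ρB →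
                   σ' Maps extendEnv K ρA a To extendEnv K ρB b
  maps-extendEnv {a = a} {b = b} {ρA = ρA} {ρB = ρB} extends σρ = maps λ where
    zero    → Equivalence.from (extends a b) (inj₂ (refl , refl))
    (suc i) → Equivalence.from (extends (ρA i) (ρB i)) (inj₁ (lookup-maps σρ i))

  partialIso-preserves-≡ : ∀ {k σ} {ρA : Fin k → Fin nA} {ρB : Fin k → Fin nB} →
                           IsPartialIso K πA πB σ → σ Maps ρA To ρB →
                           ∀ x y → ρA x ≡ ρA y ⇔ ρB x ≡ ρB y
  partialIso-preserves-≡ {σ = σ} {ρA} {ρB} (injective , _) σρ x y = mk⇔ forward backward
    where
    open ≡.≡-Reasoning

    forward : ρA x ≡ ρA y → ρB x ≡ ρB y
    forward ρAx≡ρAy = just-injective (begin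
      just (ρB x)      ≡⟨ ≡.sym (lookup-maps σρ x) ⟩
      lookup σ (ρA x)  ≡⟨ ≡.cong (lookup σ) ρAx≡ρAy ⟩
      lookup σ (ρA y)  ≡⟨ lookup-maps σρ y ⟩
      just (ρB y)      ∎)

    backward : ρB x ≡ ρB y → ρA x ≡ ρA y
    backward ρBx≡ρBy = injective (ρA x) (ρA y) (ρB y)
      (≡.trans (lookup-maps σρ x) (≡.cong just ρBx≡ρBy)) (lookup-maps σρ y)

  eval-eq-cong : ∀ {k} {ρA : Fin k → Fin nA} {ρB : Fin k → Fin nB} x y →
                 ρA x ≡ ρA y ⇔ ρB x ≡ ρB y →
                 eval K πA (eq x y) ρA ≈ eval K πB (eq x y) ρB
  eval-eq-cong {ρA = ρA} {ρB} x y same with ρA x ≟ ρA y | ρB x ≟ ρB y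
  ... | yes _ | yes _ = ≈-refl
  ... | no  _ | no  _ = ≈-refl
  ... | yes e | no ne = contradiction (Equivalence.to same e) ne
  ... | no ne | yes e = contradiction (Equivalence.from same e) ne

  eval-neq-cong : ∀ {k} {ρA : Fin k → Fin nA} {ρB : Fin k → Fin nB} x y →
                  ρA x ≡ ρA y ⇔ ρB x ≡ ρB y →
                  eval K πA (neq x y) ρA ≈ eval K πB (neq x y) ρB
  eval-neq-cong {ρA = ρA} {ρB} x y same with ρA x ≟ ρA y | ρB x ≟ ρB y
  ... | yes _ | yes _ = ≈-refl
  ... | no  _ | no  _ = ≈-refl
  ... | yes e | no ne = contradiction (Equivalence.to same e) ne
  ... | no ne | yes e = contradiction (Equivalence.from same e) ne

  module _ (idem : FullyIdempotent K) {m : ℕ} (bf : BackAndForth K m πA πB) where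
    open BackAndForth bf

    Preserved : ∀ {k} → Fin (suc m) → Formula τ k → Set ℓ
    Preserved j φ = ∀ {σ} → σ ∈ I j → ∀ {ρA ρB} → σ Maps ρA To ρB →
                    eval K πA φ ρA ≈ eval K πB φ ρB

    module _ {k} (j : Fin m) (φ : Formula τ (suc k)) (φ-preserved : Preserved (inject₁ j) φ)
             {σ : PMap K nA nB} (σ∈I : σ ∈ I (suc j))
             {ρA : Fin k → Fin nA} {ρB : Fin k → Fin nB} (σρ : σ Maps ρA To ρB) where

      forth-witness : ∀ a → ∃[ b ] eval K πA φ (extendEnv K ρA a) ≈ eval K πB φ (extendEnv K ρB b)
      forth-witness a with forth j σ σ∈I a
      ... | b , σ' , σ'∈I , extends = b , φ-preserved σ'∈I (maps-extendEnv extends σρ)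

      back-witness : ∀ b → ∃[ a ] eval K πA φ (extendEnv K ρA a) ≈ eval K πB φ (extendEnv K ρB b)
      back-witness b with back j σ σ∈I b
      ... | a , σ' , σ'∈I , extends = a , φ-preserved σ'∈I (maps-extendEnv extends σρ)

    preserved : ∀ {k} j (φ : Formula τ k) → qr φ ≤ toℕ j → Preserved j φ
    preserved j (eq x y) _ σ∈I σρ =
      eval-eq-cong x y (partialIso-preserves-≡ (All.lookup (isos j) σ∈I) σρ x y)
    preserved j (neq x y) _ σ∈I σρ =
      eval-neq-cong x y (partialIso-preserves-≡ (All.lookup (isos j) σ∈I) σρ x y)
    preserved j (rel r xs) _ σ∈I σρ =
      proj₁ (proj₂ (All.lookup (isos j) σ∈I) r _ _ (maps-vmap σρ xs))
    preserved j (notrel r xs) _ σ∈I σρ =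
      proj₂ (proj₂ (All.lookup (isos j) σ∈I) r _ _ (maps-vmap σρ xs))
    preserved j (φ ∨' ψ) q σ∈I σρ =
      +-cong (preserved j φ (≤-trans (m≤m⊔n _ _) q) σ∈I σρ)
             (preserved j ψ (≤-trans (m≤n⊔m _ _) q) σ∈I σρ)
    preserved j (φ ∧' ψ) q σ∈I σρ =
      *-cong (preserved j φ (≤-trans (m≤m⊔n _ _) q) σ∈I σρ)
             (preserved j ψ (≤-trans (m≤n⊔m _ _) q) σ∈I σρ)
    preserved (suc j) (ex φ) (s≤s q) σ∈I σρ =
      sumFin-cong-covering K (forth-witness j φ φ-preserved σ∈I σρ)
                             (back-witness j φ φ-preserved σ∈I σρ) (proj₁ idem)
      where
      φ-preserved : Preserved (inject₁ j) φ
      φ-preserved = preserved (inject₁ j) φ (subst (qr φ ≤_) (≡.sym (toℕ-inject₁ j)) q)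
    preserved (suc j) (all φ) (s≤s q) σ∈I σρ =
      prodFin-cong-covering K (forth-witness j φ φ-preserved σ∈I σρ)
                              (back-witness j φ φ-preserved σ∈I σρ) (proj₂ idem)
      where
      φ-preserved : Preserved (inject₁ j) φ
      φ-preserved = preserved (inject₁ j) φ (subst (qr φ ≤_) (≡.sym (toℕ-inject₁ j)) q)

proposition10 : ∀ {c ℓ} (K : CommutativeSemiring c ℓ) → FullyIdempotent K →
    (τ : Signature) (nA nB : ℕ) (πA : Interp K τ nA) (πB : Interp K τ nB) (m : ℕ) →
    BackAndForth K m πA πB → ElemEquiv K m πA πB
proposition10 K idem τ nA nB πA πB m bf φ qr≤m =
  preserved K idem bf (fromℕ m) φ (subst (qr φ ≤_) (≡.sym (toℕ-fromℕ m)) qr≤m)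
    (BackAndForth.empty∈ bf) (maps λ ())
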